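{- Let $w$ be an instance of Metric-MAXCUT on $V$ and let $(L,R)$ be a $\gamma$-locally stable cut ($\gamma\ge1$). Then for every $x\in L$ and $z\in R$, $$w(x,z)\ge\left(\frac{\gamma^2-1}{\gamma}\right)\cdot\frac{w(x,R)}{\gamma|R|+|L|}.$$
   Context: An instance of Metric-MAXCUT on a finite set $V$ is a metric $w:V\times V\to[0,\infty)$. For $x\in V$ and $A\subseteq V$, $w(x,A)=\sum_{a\in A}w(x,a)$. A cut $(L,R)$ is a partition $V=L\sqcup R$. It is $\gamma$-locally stable if for every vertex $x$, the total weight of edges from $x$ to the opposite side is at least $\gamma$ times the total weight of edges from $x$ to the other vertices of its own side; i.e. $w(x,R)\ge\gamma w(x,L)$ for $x\in L$ and $w(z,L)\ge\gamma w(z,R)$ for $z\in R$.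
   Formalization: The metric w takes values in the nonnegative rationals instead of $[0,\infty)$, and the stability parameter γ is rational. -}

module Defs where

open import Data.Nat using (ℕ; zero; suc)
open import Data.Fin using (Fin; zero; suc)
open import Data.Fin.Subset using (Subset; _∈_; ∁; ∣_∣; inside; outside)
open import Data.Integer using (+_)
open import Data.Rational using (ℚ; 0ℚ; _+_; _*_; _≤_; _÷_; _/_)
open import Data.Rational.Properties using (_≟_)
open import Data.Rational using (≢-nonZero)
open import Data.Vec using (lookup)
open import Relation.Binary.PropositionalEquality using (_≡_)
open import Relation.Nullary using (yes; no; ¬_)
open import Data.Product using (_×_)

ℕ→ℚ : ℕ → ℚ
ℕ→ℚ k = + k / 1

Σℚ : (n : ℕ) → (Fin n → ℚ) → ℚ
Σℚ zero    f = 0ℚ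
Σℚ (suc n) f = f zero + Σℚ n (λ i → f (suc i))

-- Total division: q ÷ 0 := 0 (only used where the denominator is provably > 0).
_÷₀_ : ℚ → ℚ → ℚ
p ÷₀ q with q ≟ 0ℚ
... | yes _  = 0ℚ
... | no q≢0 = _÷_ p q {{≢-nonZero q≢0}}

record IsMetric {n : ℕ} (w : Fin n → Fin n → ℚ) : Set where
  field
    nonneg    : ∀ x y → 0ℚ ≤ w x y
    zero-iff  : ∀ x y → (w x y ≡ 0ℚ → x ≡ y) × (x ≡ y → w x y ≡ 0ℚ)
    symmetric : ∀ x y → w x y ≡ w y x
    triangle  : ∀ x y z → w x z ≤ w x y + w y z

wSet : {n : ℕ} → (Fin n → Fin n → ℚ) → Fin n → Subset n → ℚ
wSet {n} w x A = Σℚ n (λ a → weight (lookup A a) a)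
  where
  weight : _ → Fin n → ℚ
  weight inside  a = w x a
  weight outside a = 0ℚ

-- The cut (L, R) is given by L ⊆ V, with R = ∁ L (so V = L ⊔ R).
-- γ-local stability.
LocallyStable : {n : ℕ} → (Fin n → Fin n → ℚ) → ℚ → Subset n → Set
LocallyStable w γ L =
  (∀ x → x ∈ L → γ * wSet w x L ≤ wSet w x (∁ L)) ×
  (∀ z → z ∈ ∁ L → γ * wSet w z (∁ L) ≤ wSet w z L)

{-# OPTIONS --safe #-}
-- With a = w(x,R), p = w(x,L), b = w(z,L), q = w(z,R) and d = w(x,z), summing the
-- triangle inequality through x over L and through z over R gives b ≤ |L|d + p and
-- a ≤ |R|d + q, while stability gives γp ≤ a and γq ≤ b. Hence
-- γ²a ≤ γ²|R|d + γb ≤ γ²|R|d + γ|L|d + γp ≤ γ(γ|R| + |L|)d + a,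
-- that is (γ² - 1)a ≤ γ(γ|R| + |L|)d.
module Submission where

open import Defs
open import Data.Nat using (ℕ; zero; suc)
open import Data.Fin using (Fin)
open import Data.Fin.Subset using (Subset; Side; inside; outside; _∈_; ∁; ∣_∣)
open import Data.Rational using (ℚ; 1ℚ; _+_; _-_; _*_; _≤_)

import Data.Nat as ℕ
import Data.Nat.Properties as ℕ
import Data.Integer as ℤ
import Data.Fin as Fin
open import Data.Fin.Subset.Properties using (x∈p⇒∣p-x∣<∣p∣)
open import Data.Vec using (lookup; []; _∷_)
open import Data.Rational using (0ℚ; -_; 1/_; toℚᵘ; Positive; NonNegative; positive; ≢-nonZero)
open import Data.Rational.Properties
import Data.Rational.Unnormalised as ℚᵘ
import Data.Rational.Unnormalised.Properties as ℚᵘ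
open import Data.Rational.Solver using (module +-*-Solver)
open import Data.Product using (_,_)
open import Data.Empty using (⊥-elim)
open import Relation.Nullary using (yes; no)
open import Relation.Binary.PropositionalEquality

ℕ→ℚᵘ-suc : ∀ k → ℚᵘ.mkℚᵘ (ℤ.+ suc k) 0 ℚᵘ.≃ ℚᵘ.1ℚᵘ ℚᵘ.+ ℚᵘ.mkℚᵘ (ℤ.+ k) 0
ℕ→ℚᵘ-suc zero    = ℚᵘ.*≡* refl
ℕ→ℚᵘ-suc (suc k) rewrite ℕ.*-identityʳ k = ℚᵘ.*≡* refl

ℕ→ℚ-suc : ∀ k → ℕ→ℚ (suc k) ≡ 1ℚ + ℕ→ℚ k
ℕ→ℚ-suc k = toℚᵘ-injective (begin-equality
  toℚᵘ (ℕ→ℚ (suc k))             ≃⟨ toℚᵘ-fromℚᵘ (ℚᵘ.mkℚᵘ (ℤ.+ suc k) 0) ⟩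
  ℚᵘ.mkℚᵘ (ℤ.+ suc k) 0          ≃⟨ ℕ→ℚᵘ-suc k ⟩
  ℚᵘ.1ℚᵘ ℚᵘ.+ ℚᵘ.mkℚᵘ (ℤ.+ k) 0   ≃⟨ ℚᵘ.+-congʳ ℚᵘ.1ℚᵘ (ℚᵘ.≃-sym (toℚᵘ-fromℚᵘ (ℚᵘ.mkℚᵘ (ℤ.+ k) 0))) ⟩
  ℚᵘ.1ℚᵘ ℚᵘ.+ toℚᵘ (ℕ→ℚ k)        ≃⟨ ℚᵘ.≃-sym (toℚᵘ-homo-+ 1ℚ (ℕ→ℚ k)) ⟩
  toℚᵘ (1ℚ + ℕ→ℚ k)              ∎)
  where open ℚᵘ.≤-Reasoning

ℕ→ℚ-nonNeg : ∀ k → NonNegative (ℕ→ℚ k)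
ℕ→ℚ-nonNeg k = normalize-nonNeg k 1

ℕ→ℚ-pos : ∀ k .{{_ : ℕ.NonZero k}} → Positive (ℕ→ℚ k)
ℕ→ℚ-pos k = normalize-pos k 1

x∈p⇒∣p∣-nonZero : ∀ {n} {x : Fin n} {p : Subset n} → x ∈ p → ℕ.NonZero ∣ p ∣
x∈p⇒∣p∣-nonZero x∈p = ℕ.>-nonZero (ℕ.≤-<-trans ℕ.z≤n (x∈p⇒∣p-x∣<∣p∣ x∈p))

p÷₀q*q≡p : ∀ p q .{{_ : Positive q}} → (p ÷₀ q) * q ≡ p
p÷₀q*q≡p p q with q ≟ 0ℚ
... | yes q≡0 = ⊥-elim (<-irrefl (sym q≡0) (positive⁻¹ q))
... | no  q≢0 = begin
  p * 1/ q * q    ≡⟨ *-assoc p (1/ q) q ⟩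
  p * (1/ q * q)  ≡⟨ cong (p *_) (*-inverseˡ q) ⟩
  p * 1ℚ          ≡⟨ *-identityʳ p ⟩
  p               ∎
  where
  open ≡-Reasoning
  instance _ = ≢-nonZero q≢0

p*q≤r*[s*t]⇒[p÷₀s]*[q÷₀t]≤r : ∀ p q r s t .{{_ : Positive s}} .{{_ : Positive t}} →
  p * q ≤ r * (s * t) → (p ÷₀ s) * (q ÷₀ t) ≤ r
p*q≤r*[s*t]⇒[p÷₀s]*[q÷₀t]≤r p q r s t pq≤rst = *-cancelʳ-≤-pos (s * t) (begin
  (p ÷₀ s) * (q ÷₀ t) * (s * t)  ≡⟨ solve 4 (λ x y s t → x :* y :* (s :* t) := (x :* s) :* (y :* t)) refl (p ÷₀ s) (q ÷₀ t) s t ⟩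
  ((p ÷₀ s) * s) * ((q ÷₀ t) * t) ≡⟨ cong₂ _*_ (p÷₀q*q≡p p s) (p÷₀q*q≡p q t) ⟩
  p * q                          ≤⟨ pq≤rst ⟩
  r * (s * t)                    ∎)
  where
  open +-*-Solver
  open ≤-Reasoning
  instance _ = pos*pos⇒pos s t

Σℚ-cong : ∀ n {f g : Fin n → ℚ} → (∀ i → f i ≡ g i) → Σℚ n f ≡ Σℚ n g
Σℚ-cong zero    f≡g = refl
Σℚ-cong (suc n) f≡g = cong₂ _+_ (f≡g Fin.zero) (Σℚ-cong n (λ i → f≡g (Fin.suc i)))

Σℚ-mono-≤ : ∀ n {f g : Fin n → ℚ} → (∀ i → f i ≤ g i) → Σℚ n f ≤ Σℚ n g
Σℚ-mono-≤ zero    f≤g = ≤-refl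
Σℚ-mono-≤ (suc n) f≤g = +-mono-≤ (f≤g Fin.zero) (Σℚ-mono-≤ n (λ i → f≤g (Fin.suc i)))

Σℚ-distrib-+ : ∀ n (f g : Fin n → ℚ) → Σℚ n (λ i → f i + g i) ≡ Σℚ n f + Σℚ n g
Σℚ-distrib-+ zero    f g = sym (+-identityˡ 0ℚ)
Σℚ-distrib-+ (suc n) f g = begin
  (f₀ + g₀) + Σℚ n (λ i → f (Fin.suc i) + g (Fin.suc i))
    ≡⟨ cong ((f₀ + g₀) +_) (Σℚ-distrib-+ n (λ i → f (Fin.suc i)) (λ i → g (Fin.suc i))) ⟩
  (f₀ + g₀) + (Σf + Σg)
    ≡⟨ solve 4 (λ a b c d → (a :+ b) :+ (c :+ d) := (a :+ c) :+ (b :+ d)) refl f₀ g₀ Σf Σg ⟩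
  (f₀ + Σf) + (g₀ + Σg) ∎
  where
  open +-*-Solver
  open ≡-Reasoning
  f₀ = f Fin.zero
  g₀ = g Fin.zero
  Σf = Σℚ n (λ i → f (Fin.suc i))
  Σg = Σℚ n (λ i → g (Fin.suc i))

when : Side → ℚ → ℚ
when inside  q = q
when outside q = 0ℚ

Σ∈ : ∀ {n} → Subset n → (Fin n → ℚ) → ℚ
Σ∈ {n} A f = Σℚ n (λ a → when (lookup A a) (f a))

-- The summand of wSet is local to Defs, so its type is left to unification with wSet≡Σ∈.
mutual
  wSet≡Σ∈ : ∀ {n} (w : Fin n → Fin n → ℚ) x (A : Subset n) → wSet w x A ≡ Σ∈ A (w x)
  wSet≡Σ∈ {n} w x A = Σℚ-cong n (wSet-summand≡when w x A)

  wSet-summand≡when : ∀ {n} (w : Fin n → Fin n → ℚ) x (A : Subset n) a → _ ≡ when (lookup A a) (w x a)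
  wSet-summand≡when w x A a with lookup A a
  ... | inside  = refl
  ... | outside = refl

Σ∈-mono-≤ : ∀ {n} (A : Subset n) {f g : Fin n → ℚ} → (∀ a → f a ≤ g a) → Σ∈ A f ≤ Σ∈ A g
Σ∈-mono-≤ {n} A f≤g = Σℚ-mono-≤ n (λ a → when-mono (lookup A a) (f≤g a))
  where
  when-mono : ∀ s {p q} → p ≤ q → when s p ≤ when s q
  when-mono inside  p≤q = p≤q
  when-mono outside p≤q = ≤-refl

Σ∈-distrib-+ : ∀ {n} (A : Subset n) (f g : Fin n → ℚ) →
  Σ∈ A (λ a → f a + g a) ≡ Σ∈ A f + Σ∈ A g
Σ∈-distrib-+ {n} A f g =
  trans (Σℚ-cong n (λ a → when-distrib (lookup A a))) (Σℚ-distrib-+ n _ _)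
  where
  when-distrib : ∀ s {p q} → when s (p + q) ≡ when s p + when s q
  when-distrib inside  = refl
  when-distrib outside = sym (+-identityˡ 0ℚ)

Σ∈-const : ∀ {n} (A : Subset n) c → Σ∈ A (λ _ → c) ≡ ℕ→ℚ ∣ A ∣ * c
Σ∈-const []            c = sym (*-zeroˡ c)
Σ∈-const (outside ∷ A) c = trans (+-identityˡ _) (Σ∈-const A c)
Σ∈-const (inside  ∷ A) c = begin
  c + Σ∈ A (λ _ → c)       ≡⟨ cong (c +_) (Σ∈-const A c) ⟩
  c + ℕ→ℚ ∣ A ∣ * c        ≡⟨ cong (_+ ℕ→ℚ ∣ A ∣ * c) (sym (*-identityˡ c)) ⟩
  1ℚ * c + ℕ→ℚ ∣ A ∣ * c   ≡⟨ sym (*-distribʳ-+ c 1ℚ (ℕ→ℚ ∣ A ∣)) ⟩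
  (1ℚ + ℕ→ℚ ∣ A ∣) * c     ≡⟨ cong (_* c) (sym (ℕ→ℚ-suc ∣ A ∣)) ⟩
  ℕ→ℚ (suc ∣ A ∣) * c      ∎
  where open ≡-Reasoning

wSet-triangle : ∀ {n} {w : Fin n → Fin n → ℚ} → IsMetric w → ∀ z x (A : Subset n) →
  wSet w z A ≤ ℕ→ℚ ∣ A ∣ * w z x + wSet w x A
wSet-triangle {w = w} metric z x A = begin
  wSet w z A                               ≡⟨ wSet≡Σ∈ w z A ⟩
  Σ∈ A (w z)                               ≤⟨ Σ∈-mono-≤ A (IsMetric.triangle metric z x) ⟩
  Σ∈ A (λ a → w z x + w x a)               ≡⟨ Σ∈-distrib-+ A (λ _ → w z x) (w x) ⟩
  Σ∈ A (λ _ → w z x) + Σ∈ A (w x)          ≡⟨ cong₂ _+_ (Σ∈-const A (w z x)) (sym (wSet≡Σ∈ w x A)) ⟩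
  ℕ→ℚ ∣ A ∣ * w z x + wSet w x A           ∎
  where open ≤-Reasoning

stable-cut-inequality : ∀ γ a b p q d l r .{{_ : NonNegative γ}} →
  b ≤ l * d + p → a ≤ r * d + q → γ * p ≤ a → γ * q ≤ b →
  (γ * γ - 1ℚ) * a ≤ d * (γ * (γ * r + l))
stable-cut-inequality γ a b p q d l r b≤ld+p a≤rd+q γp≤a γq≤b = begin
  (γ * γ - 1ℚ) * a                            ≡⟨ solve 2 (λ γ a → (γ :* γ :- con 1ℚ) :* a := γ :* γ :* a :- a) refl γ a ⟩
  γ * γ * a - a                               ≤⟨ +-monoˡ-≤ (- a) γ²a≤ ⟩
  (γ * γ * (r * d) + γ * (l * d) + a) - a     ≡⟨ solve 5 (λ γ a d l r → γ :* γ :* (r :* d) :+ γ :* (l :* d) :+ a :- a := d :* (γ :* (γ :* r :+ l))) refl γ a d l r ⟩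
  d * (γ * (γ * r + l))                       ∎
  where
  open +-*-Solver
  open ≤-Reasoning
  instance _ = nonNeg*nonNeg⇒nonNeg γ γ
  γ²a≤ : γ * γ * a ≤ γ * γ * (r * d) + γ * (l * d) + a
  γ²a≤ = begin
    γ * γ * a                                ≤⟨ *-monoˡ-≤-nonNeg (γ * γ) a≤rd+q ⟩
    γ * γ * (r * d + q)                      ≡⟨ solve 4 (λ γ r d q → γ :* γ :* (r :* d :+ q) := γ :* γ :* (r :* d) :+ γ :* (γ :* q)) refl γ r d q ⟩
    γ * γ * (r * d) + γ * (γ * q)            ≤⟨ +-monoʳ-≤ (γ * γ * (r * d)) (*-monoˡ-≤-nonNeg γ (≤-trans γq≤b b≤ld+p)) ⟩
    γ * γ * (r * d) + γ * (l * d + p)        ≡⟨ solve 5 (λ γ r d l p → γ :* γ :* (r :* d) :+ γ :* (l :* d :+ p) := γ :* γ :* (r :* d) :+ γ :* (l :* d) :+ γ :* p) refl γ r d l p ⟩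
    γ * γ * (r * d) + γ * (l * d) + γ * p    ≤⟨ +-monoʳ-≤ (γ * γ * (r * d) + γ * (l * d)) γp≤a ⟩
    γ * γ * (r * d) + γ * (l * d) + a        ∎

proposition3 : (n : ℕ) (w : Fin n → Fin n → ℚ) → IsMetric w →
    (γ : ℚ) → 1ℚ ≤ γ → (L : Subset n) → LocallyStable w γ L →
    ∀ x z → x ∈ L → z ∈ ∁ L →
    ((γ * γ - 1ℚ) ÷₀ γ) * (wSet w x (∁ L) ÷₀ (γ * ℕ→ℚ ∣ ∁ L ∣ + ℕ→ℚ ∣ L ∣)) ≤ w x z
proposition3 n w metric γ 1≤γ L (stableL , stableR) x z x∈L z∈R =
  p*q≤r*[s*t]⇒[p÷₀s]*[q÷₀t]≤r (γ * γ - 1ℚ) (wSet w x R) (w x z) γ (γ * r + l)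
    (stable-cut-inequality γ (wSet w x R) (wSet w z L) (wSet w x L) (wSet w z R) (w x z) l r
      (subst (λ d → wSet w z L ≤ l * d + wSet w x L) (IsMetric.symmetric metric z x)
        (wSet-triangle metric z x L))
      (wSet-triangle metric x z R)
      (stableL x x∈L)
      (stableR z z∈R))
  where
  R = ∁ L
  l = ℕ→ℚ ∣ L ∣
  r = ℕ→ℚ ∣ R ∣
  instance
    γ-pos : Positive γ
    γ-pos = positive (<-≤-trans (positive⁻¹ 1ℚ) 1≤γ)
    γ-nonNeg : NonNegative γ
    γ-nonNeg = pos⇒nonNeg γ
    ∣L∣-nonZero : ℕ.NonZero ∣ L ∣
    ∣L∣-nonZero = x∈p⇒∣p∣-nonZero x∈L
    _ = ℕ→ℚ-nonNeg ∣ R ∣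
    _ = ℕ→ℚ-pos ∣ L ∣
    D-pos : Positive (γ * r + l)
    D-pos = nonNeg+pos⇒pos (γ * r) {{nonNeg*nonNeg⇒nonNeg γ r}} l
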